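{- Let $A=\{a_1<\dots<a_m\}$ and $B=\{b_1<\dots<b_n\}$ be finite totally ordered sets. Let $(a_{i_1},b_{j_1}),\dots,(a_{i_k},b_{j_k})$, $k\ge1$, be pairs with $a_{i_1}<\dots<a_{i_k}$ and $b_{j_1}<\dots<b_{j_k}$. Then there exist monotone non-decreasing maps $x:A\to B$ and $y:B\to A$ such that $\{(a,b)\in A\times B: x(a)=b,\ y(b)=a\}=\{(a_{i_1},b_{j_1}),\dots,(a_{i_k},b_{j_k})\}$. -}

module Defs where

open import Data.Nat using (ℕ)
open import Data.Fin using (Fin; _<_; _≤_)

StrictlyIncreasing : {k m : ℕ} → (Fin k → Fin m) → Set
StrictlyIncreasing {k} f = ∀ (s t : Fin k) → s < t → f s < f t

Monotone : {m n : ℕ} → (Fin m → Fin n) → Set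
Monotone {m} f = ∀ (a a′ : Fin m) → a ≤ a′ → f a ≤ f a′

-- A strictly increasing i : Fin (suc k) → Fin m has a monotone left inverse σ, sending a to the
-- largest s with i s ≤ a (or to 0 if there is none).  With τ the analogous left inverse of j, the
-- maps x = j ∘ σ and y = i ∘ τ are monotone, and x a ≡ b, y b ≡ a force a = i (τ b) and then
-- b = j (σ (i (τ b))) = j (τ b).
module Submission where

open import Defs
open import Data.Nat using (ℕ; suc; z≤n; s≤s)
open import Data.Fin using (Fin; zero; suc; _≤_; _≟_)
open import Data.Fin.Properties using (_≤?_; ≤-refl; ≤-trans; ≤∧≢⇒<)
open import Data.Nat.Properties using (<⇒≤; <⇒≱)
open import Data.Product using (Σ; ∃; _×_; _,_)
open import Function.Base using (_∘_)
open import Function.Bundles using (_⇔_; mk⇔)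
open import Relation.Binary.PropositionalEquality using (_≡_; refl; sym; cong; module ≡-Reasoning)
open import Relation.Nullary using (yes; no; contradiction)

Monotone-∘ : {l m n : ℕ} {g : Fin m → Fin n} {f : Fin l → Fin m} →
             Monotone g → Monotone f → Monotone (g ∘ f)
Monotone-∘ g-mono f-mono a a′ = g-mono _ _ ∘ f-mono a a′

StrictlyIncreasing⇒Monotone : {k m : ℕ} {f : Fin k → Fin m} →
                              StrictlyIncreasing f → Monotone f
StrictlyIncreasing⇒Monotone {f = f} f-strict s t s≤t with s ≟ t
... | yes refl = ≤-refl
... | no s≢t   = <⇒≤ (f-strict s t (≤∧≢⇒< s≤t s≢t))

retract : {k m : ℕ} → (Fin (suc k) → Fin m) → Fin m → Fin (suc k)
retract {ℕ.zero} i a = zero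
retract {suc k}  i a with i (suc zero) ≤? a
... | yes _ = suc (retract (i ∘ suc) a)
... | no _  = zero

retract-monotone : {k m : ℕ} (i : Fin (suc k) → Fin m) → Monotone (retract i)
retract-monotone {ℕ.zero} i a a′ a≤a′ = z≤n
retract-monotone {suc k}  i a a′ a≤a′ with i (suc zero) ≤? a | i (suc zero) ≤? a′
... | yes _    | yes _     = s≤s (retract-monotone (i ∘ suc) a a′ a≤a′)
... | yes i₁≤a | no i₁≰a′ = contradiction (≤-trans i₁≤a a≤a′) i₁≰a′
... | no _     | _         = z≤n

retract-inverseˡ : {k m : ℕ} {i : Fin (suc k) → Fin m} →
                   StrictlyIncreasing i → ∀ t → retract i (i t) ≡ t
retract-inverseˡ {ℕ.zero} _ zero = refl
retract-inverseˡ {suc k} {i = i} i-strict t with i (suc zero) ≤? i t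
retract-inverseˡ i-strict zero    | yes i₁≤i₀ = contradiction i₁≤i₀ (<⇒≱ (i-strict zero (suc zero) (s≤s z≤n)))
retract-inverseˡ i-strict (suc t) | yes _     =
  cong suc (retract-inverseˡ (λ s t → i-strict (suc s) (suc t) ∘ s≤s) t)
retract-inverseˡ i-strict zero    | no _      = refl
retract-inverseˡ i-strict (suc t) | no i₁≰iₜ =
  contradiction (StrictlyIncreasing⇒Monotone i-strict (suc zero) (suc t) (s≤s z≤n)) i₁≰iₜ

proposition4 : (m n k : ℕ) → (i : Fin (suc k) → Fin m) → (j : Fin (suc k) → Fin n)
    → StrictlyIncreasing i → StrictlyIncreasing j
    → Σ (Fin m → Fin n) λ x → Σ (Fin n → Fin m) λ y
    → Monotone x × Monotone y
    × (∀ (a : Fin m) (b : Fin n) → ((x a ≡ b) × (y b ≡ a)) ⇔ (∃ λ t → (i t ≡ a) × (j t ≡ b)))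
proposition4 m n _ i j i-strict j-strict =
  x , y ,
  Monotone-∘ (StrictlyIncreasing⇒Monotone j-strict) (retract-monotone i) ,
  Monotone-∘ (StrictlyIncreasing⇒Monotone i-strict) (retract-monotone j) ,
  λ a b → mk⇔ (fixed⇒pair a b) (pair⇒fixed a b)
  where
  x : Fin m → Fin n
  x = j ∘ retract i

  y : Fin n → Fin m
  y = i ∘ retract j

  fixed⇒pair : ∀ a b → (x a ≡ b) × (y b ≡ a) → ∃ λ t → (i t ≡ a) × (j t ≡ b)
  fixed⇒pair a b (xa≡b , refl) = retract j b , refl , (begin
    j (retract j b)                 ≡⟨ cong j (sym (retract-inverseˡ i-strict (retract j b))) ⟩
    j (retract i (i (retract j b))) ≡⟨ xa≡b ⟩
    b                               ∎)
    where open ≡-Reasoning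

  pair⇒fixed : ∀ a b → (∃ λ t → (i t ≡ a) × (j t ≡ b)) → (x a ≡ b) × (y b ≡ a)
  pair⇒fixed a b (t , refl , refl) =
    cong j (retract-inverseˡ i-strict t) , cong i (retract-inverseˡ j-strict t)
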